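{- Let $(a_n)_{n=0}^\infty$ be a sequence of integers such that $a_0>0$, $a_1\ge 1$, $a_0\le a_1$, $a_n=a_{n-1}+a_{n-2}$ for all $n\ge 2$, and $\chi:=a_0^2+a_1a_0-a_1^2>0$. For each integer $n\ge 0$ let $\xi(n)$ be the largest nonnegative integer such that $$a_{2n+2}F_{\xi(n)}+a_{2n+3}F_{\xi(n)+1}\le \frac{a_{2n+2}a_{2n+3}a_{2n+4}}{\chi}.$$ Then for every $n\ge 0$, $\xi(n)$ is the largest nonnegative integer such that $$\frac{1}{a_{2n+3+\xi(n)}}\ \ge\ \frac{\chi}{a_{2n+2}a_{2n+3}a_{2n+4}},$$ and moreover $$\frac{1}{a_{2n+3}}+\frac{1}{a_{2n+4}}\ \le\ \frac{1}{a_{2n+2}}+\frac{1}{a_{2n+3+\xi(n)}}.$$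
   Context: $(F_n)$ is the Fibonacci sequence: $F_0=0$, $F_1=1$, $F_n=F_{n-1}+F_{n-2}$. -}

module Defs where

open import Data.Nat as ℕ using (ℕ; zero; suc)
open import Data.Integer as ℤ using (ℤ)
open import Data.Rational as ℚ using (ℚ; 0ℚ; 1ℚ; _/_; 1/_; _÷_)
open import Data.Rational.Properties using (_≟_)
open import Data.Product using (_×_)
open import Relation.Nullary using (yes; no)

F : ℕ → ℕ
F zero = 0
F (suc zero) = 1
F (suc (suc n)) = F (suc n) ℕ.+ F n

toℚ : ℤ → ℚ
toℚ z = z / 1

-- total reciprocal on ℚ (junk value 0 at 0; only ever applied to nonzero values below)
inv : ℚ → ℚ
inv p with p ≟ 0ℚ
... | yes _ = 0ℚ
... | no p≢0 = 1/_ p {{ℚ.≢-nonZero p≢0}}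

IsGreatest : (ℕ → Set) → ℕ → Set
IsGreatest P k = P k × (∀ m → P m → m ℕ.≤ k)

{-# OPTIONS --safe #-}
module Submission where

-- Write x, y, z for a₂ₙ₊₂, a₂ₙ₊₃, a₂ₙ₊₄. The form χ u v = u² + vu − v² satisfies
-- χ v (v + u) = − χ u v, so along the recurrence it alternates in sign and
-- χ x y = χ a₀ a₁ = χ. The shift identity a_m F_k + a_{m+1} F_{k+1} = a_{m+1+k} turns
-- the defining condition of ξ(n) into a_{2n+3+k} ≤ xyz/χ, which for positive
-- quantities is equivalent to χ/(xyz) ≤ 1/a_{2n+3+k}. Adding 1/x to the case k = ξ(n)
-- gives the inequality, because 1/y + 1/z = 1/x + (xz + xy − yz)/(xyz) and, as z = x + y,
-- the numerator is χ x y.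

open import Defs
open import Data.Nat as ℕ using (ℕ; zero; suc; _+_; _*_)
import Data.Nat.Properties as ℕP
import Data.Nat.Tactic.RingSolver as ℕSolver
open import Data.Integer as ℤ using (ℤ)
import Data.Integer.Properties as ℤP
import Data.Integer.Tactic.RingSolver as ℤSolver
open import Data.Rational as ℚ using (ℚ; 0ℚ; 1ℚ)
open import Data.Rational.Literals using (fromℤ)
import Data.Rational.Properties as ℚP
open import Data.Rational.Solver using (module +-*-Solver)
open import Data.Product using (_×_; _,_; proj₁; <_,_>)
open import Function.Base using (id; _∘_)
open import Function.Bundles using (_⇔_; mk⇔; module Equivalence)
open import Relation.Nullary using (yes; no; contradiction)
open import Relation.Binary.PropositionalEquality
  using (_≡_; _≢_; refl; sym; trans; cong; cong₂; subst; subst₂; ≢-sym; module ≡-Reasoning)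

open ≡-Reasoning

toℚ≡fromℤ : ∀ i → toℚ i ≡ fromℤ i
toℚ≡fromℤ i = ℚP.↥p/↧p≡p (fromℤ i)

toℚ-* : ∀ i j → toℚ (i ℤ.* j) ≡ toℚ i ℚ.* toℚ j
toℚ-* i j = sym (cong₂ ℚ._*_ (toℚ≡fromℤ i) (toℚ≡fromℤ j))

toℚ-+ : ∀ i j → toℚ (i ℤ.+ j) ≡ toℚ i ℚ.+ toℚ j
toℚ-+ i j = begin
  toℚ (i ℤ.+ j)
    ≡⟨ cong₂ (λ s t → toℚ (s ℤ.+ t)) (sym (ℤP.*-identityʳ i)) (sym (ℤP.*-identityʳ j)) ⟩
  toℚ (i ℤ.* ℤ.1ℤ ℤ.+ j ℤ.* ℤ.1ℤ)
    ≡⟨⟩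
  fromℤ i ℚ.+ fromℤ j
    ≡⟨ sym (cong₂ ℚ._+_ (toℚ≡fromℤ i) (toℚ≡fromℤ j)) ⟩
  toℚ i ℚ.+ toℚ j ∎

fromℤ-neg : ∀ i → fromℤ (ℤ.- i) ≡ ℚ.- fromℤ i
fromℤ-neg (ℤ.+ zero) = refl
fromℤ-neg ℤ.+[1+ n ] = refl
fromℤ-neg ℤ.-[1+ n ] = refl

toℚ-- : ∀ i j → toℚ (i ℤ.- j) ≡ toℚ i ℚ.- toℚ j
toℚ-- i j = begin
  toℚ (i ℤ.- j)             ≡⟨ toℚ-+ i (ℤ.- j) ⟩
  toℚ i ℚ.+ toℚ (ℤ.- j)     ≡⟨ cong (toℚ i ℚ.+_) (toℚ≡fromℤ (ℤ.- j)) ⟩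
  toℚ i ℚ.+ fromℤ (ℤ.- j)   ≡⟨ cong (toℚ i ℚ.+_) (fromℤ-neg j) ⟩
  toℚ i ℚ.- fromℤ j         ≡⟨ cong (λ t → toℚ i ℚ.- t) (sym (toℚ≡fromℤ j)) ⟩
  toℚ i ℚ.- toℚ j ∎

toℚ-pos : ∀ {i} → ℤ.0ℤ ℤ.< i → 0ℚ ℚ.< toℚ i
toℚ-pos {i} 0<i rewrite toℚ≡fromℤ i = ℚP.positive⁻¹ (fromℤ i) {{ℤ.positive 0<i}}

*-inverseʳ-inv : ∀ {p} → p ≢ 0ℚ → p ℚ.* inv p ≡ 1ℚ
*-inverseʳ-inv {p} p≢0 with p ℚP.≟ 0ℚ
... | yes p≡0  = contradiction p≡0 p≢0
... | no  p≢0′ = ℚP.*-inverseʳ p {{ℚ.≢-nonZero p≢0′}}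

inv-pos : ∀ {p} → 0ℚ ℚ.< p → 0ℚ ℚ.< inv p
inv-pos {p} 0<p with p ℚP.≟ 0ℚ
... | yes p≡0 = contradiction (sym p≡0) (ℚP.<⇒≢ 0<p)
... | no  p≢0 = ℚP.positive⁻¹ _ {{ℚP.1/pos⇒pos p {{ℚ.positive 0<p}}}}

inv-unique : ∀ {p q} → p ℚ.* q ≡ 1ℚ → inv p ≡ q
inv-unique {p} {q} pq≡1 with p ℚP.≟ 0ℚ
... | yes refl = contradiction (trans (sym (ℚP.*-zeroˡ q)) pq≡1) (≢-sym ℚP.1≢0)
... | no  p≢0  = begin
  1/p                ≡⟨ sym (ℚP.*-identityʳ 1/p) ⟩
  1/p ℚ.* 1ℚ         ≡⟨ cong (1/p ℚ.*_) (sym pq≡1) ⟩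
  1/p ℚ.* (p ℚ.* q)  ≡⟨ sym (ℚP.*-assoc 1/p p q) ⟩
  1/p ℚ.* p ℚ.* q    ≡⟨ cong (ℚ._* q) (ℚP.*-inverseˡ p {{ℚ.≢-nonZero p≢0}}) ⟩
  1ℚ ℚ.* q           ≡⟨ ℚP.*-identityˡ q ⟩
  q ∎
  where 1/p = ℚ.1/_ p {{ℚ.≢-nonZero p≢0}}

*-pos : ∀ {p q} → 0ℚ ℚ.< p → 0ℚ ℚ.< q → 0ℚ ℚ.< p ℚ.* q
*-pos {p} {q} 0<p 0<q = ℚP.positive⁻¹ _ {{ℚP.pos*pos⇒pos p {{ℚ.positive 0<p}} q {{ℚ.positive 0<q}}}}

pos⇒≢0 : ∀ {p} → 0ℚ ℚ.< p → p ≢ 0ℚ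
pos⇒≢0 0<p = ≢-sym (ℚP.<⇒≢ 0<p)

*-monoʳ-≤⇔ : ∀ {p q r} → 0ℚ ℚ.< r → (p ℚ.≤ q) ⇔ (p ℚ.* r ℚ.≤ q ℚ.* r)
*-monoʳ-≤⇔ {r = r} 0<r =
  mk⇔ (ℚP.*-monoʳ-≤-nonNeg r {{ℚ.nonNegative (ℚP.<⇒≤ 0<r)}})
      (ℚP.*-cancelʳ-≤-pos r {{ℚ.positive 0<r}})

≤-*-inv⇔-*-inv-≤-inv : ∀ {x y z} → 0ℚ ℚ.< x → 0ℚ ℚ.< y → 0ℚ ℚ.< z →
                       (x ℚ.≤ y ℚ.* inv z) ⇔ (z ℚ.* inv y ℚ.≤ inv x)
≤-*-inv⇔-*-inv-≤-inv {x} {y} {z} 0<x 0<y 0<z =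
  subst₂ (λ s t → (x ℚ.≤ y ℚ.* inv z) ⇔ (s ℚ.≤ t))
         x*c≡z*inv-y y*inv-z*c≡inv-x (*-monoʳ-≤⇔ 0<c)
  where
  open +-*-Solver
  c : ℚ
  c = z ℚ.* inv x ℚ.* inv y
  0<c : 0ℚ ℚ.< c
  0<c = *-pos (*-pos 0<z (inv-pos 0<x)) (inv-pos 0<y)
  x*c≡z*inv-y : x ℚ.* c ≡ z ℚ.* inv y
  x*c≡z*inv-y = begin
    x ℚ.* (z ℚ.* inv x ℚ.* inv y)   ≡⟨ solve 4 (λ x z u v → x :* (z :* u :* v) := (x :* u) :* (z :* v))
                                                refl x z (inv x) (inv y) ⟩
    x ℚ.* inv x ℚ.* (z ℚ.* inv y)   ≡⟨ cong (ℚ._* (z ℚ.* inv y)) (*-inverseʳ-inv (pos⇒≢0 0<x)) ⟩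
    1ℚ ℚ.* (z ℚ.* inv y)            ≡⟨ ℚP.*-identityˡ _ ⟩
    z ℚ.* inv y ∎
  y*inv-z*c≡inv-x : y ℚ.* inv z ℚ.* c ≡ inv x
  y*inv-z*c≡inv-x = begin
    y ℚ.* inv z ℚ.* (z ℚ.* inv x ℚ.* inv y)
      ≡⟨ solve 5 (λ y z u v w → y :* w :* (z :* u :* v) := (y :* v) :* (z :* w) :* u)
           refl y z (inv x) (inv y) (inv z) ⟩
    y ℚ.* inv y ℚ.* (z ℚ.* inv z) ℚ.* inv x
      ≡⟨ cong₂ (λ s t → s ℚ.* t ℚ.* inv x) (*-inverseʳ-inv (pos⇒≢0 0<y)) (*-inverseʳ-inv (pos⇒≢0 0<z)) ⟩
    1ℚ ℚ.* 1ℚ ℚ.* inv x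
      ≡⟨ ℚP.*-identityˡ (inv x) ⟩
    inv x ∎

inv+inv≡inv+[xz+xy-yz]*inv[xyz] :
  ∀ {x y z} → x ≢ 0ℚ → y ≢ 0ℚ → z ≢ 0ℚ →
  inv y ℚ.+ inv z ≡ inv x ℚ.+ (x ℚ.* z ℚ.+ x ℚ.* y ℚ.- y ℚ.* z) ℚ.* inv (x ℚ.* y ℚ.* z)
inv+inv≡inv+[xz+xy-yz]*inv[xyz] {x} {y} {z} x≢0 y≢0 z≢0 = sym (begin
  u ℚ.+ (x ℚ.* z ℚ.+ x ℚ.* y ℚ.- y ℚ.* z) ℚ.* inv (x ℚ.* y ℚ.* z)
    ≡⟨ cong (λ t → u ℚ.+ (x ℚ.* z ℚ.+ x ℚ.* y ℚ.- y ℚ.* z) ℚ.* t) inv-xyz ⟩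
  u ℚ.+ (x ℚ.* z ℚ.+ x ℚ.* y ℚ.- y ℚ.* z) ℚ.* (u ℚ.* v ℚ.* w)
    ≡⟨ solve 6 (λ x y z u v w →
         u :+ (x :* z :+ x :* y :- y :* z) :* (u :* v :* w)
         := u :+ (x :* u) :* (z :* w) :* v :+ (x :* u) :* (y :* v) :* w :- (y :* v) :* (z :* w) :* u)
       refl x y z u v w ⟩
  u ℚ.+ x ℚ.* u ℚ.* (z ℚ.* w) ℚ.* v ℚ.+ x ℚ.* u ℚ.* (y ℚ.* v) ℚ.* w ℚ.- y ℚ.* v ℚ.* (z ℚ.* w) ℚ.* u
    ≡⟨ collapse xu≡1 yv≡1 zw≡1 ⟩
  v ℚ.+ w ∎)
  where
  open +-*-Solver
  u v w : ℚ
  u = inv x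
  v = inv y
  w = inv z
  xu≡1 : x ℚ.* u ≡ 1ℚ
  xu≡1 = *-inverseʳ-inv x≢0
  yv≡1 : y ℚ.* v ≡ 1ℚ
  yv≡1 = *-inverseʳ-inv y≢0
  zw≡1 : z ℚ.* w ≡ 1ℚ
  zw≡1 = *-inverseʳ-inv z≢0
  collapse : ∀ {s t r} → s ≡ 1ℚ → t ≡ 1ℚ → r ≡ 1ℚ →
             u ℚ.+ s ℚ.* r ℚ.* v ℚ.+ s ℚ.* t ℚ.* w ℚ.- t ℚ.* r ℚ.* u ≡ v ℚ.+ w
  collapse refl refl refl =
    solve 3 (λ u v w → u :+ con 1ℚ :* con 1ℚ :* v :+ con 1ℚ :* con 1ℚ :* w :- con 1ℚ :* con 1ℚ :* u
                       := v :+ w)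
      refl u v w
  inv-xyz : inv (x ℚ.* y ℚ.* z) ≡ u ℚ.* v ℚ.* w
  inv-xyz = inv-unique {x ℚ.* y ℚ.* z} (begin
    x ℚ.* y ℚ.* z ℚ.* (u ℚ.* v ℚ.* w)      ≡⟨ solve 6 (λ x y z u v w → x :* y :* z :* (u :* v :* w)
                                                         := (x :* u) :* (y :* v) :* (z :* w))
                                                 refl x y z u v w ⟩
    x ℚ.* u ℚ.* (y ℚ.* v) ℚ.* (z ℚ.* w)    ≡⟨ cong₂ ℚ._*_ (cong₂ ℚ._*_ xu≡1 yv≡1) zw≡1 ⟩
    1ℚ ℚ.* 1ℚ ℚ.* 1ℚ                       ≡⟨⟩
    1ℚ ∎)

IsGreatest-cong : ∀ {P Q : ℕ → Set} {m} → (∀ k → P k ⇔ Q k) → IsGreatest P m → IsGreatest Q m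
IsGreatest-cong P⇔Q (Pm , P≤m) =
  Equivalence.to (P⇔Q _) Pm , λ k Qk → P≤m k (Equivalence.from (P⇔Q k) Qk)

χ : ℤ → ℤ → ℤ
χ x y = x ℤ.* x ℤ.+ y ℤ.* x ℤ.- y ℤ.* y

χ-step : ∀ x y → χ y (y ℤ.+ x) ≡ ℤ.- χ x y
χ-step = lemma
  where
  -- solve-∀ does not unfold χ, so the identity is restated with χ expanded.
  lemma : ∀ x y → y ℤ.* y ℤ.+ (y ℤ.+ x) ℤ.* y ℤ.- (y ℤ.+ x) ℤ.* (y ℤ.+ x)
                  ≡ ℤ.- (x ℤ.* x ℤ.+ y ℤ.* x ℤ.- y ℤ.* y)
  lemma = ℤSolver.solve-∀

χ≡xz+xy-yz : ∀ x y z → z ≡ y ℤ.+ x → χ x y ≡ x ℤ.* z ℤ.+ x ℤ.* y ℤ.- y ℤ.* z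
χ≡xz+xy-yz x y _ refl = lemma x y
  where
  lemma : ∀ x y → x ℤ.* x ℤ.+ y ℤ.* x ℤ.- y ℤ.* y ≡ x ℤ.* (y ℤ.+ x) ℤ.+ x ℤ.* y ℤ.- y ℤ.* (y ℤ.+ x)
  lemma = ℤSolver.solve-∀

module FibonacciLike (a : ℕ → ℤ) (a-rec : ∀ n → a (2 + n) ≡ a (1 + n) ℤ.+ a n) where

  all-positive : ℤ.0ℤ ℤ.< a 0 → ℤ.0ℤ ℤ.< a 1 → ∀ n → ℤ.0ℤ ℤ.< a n
  all-positive 0<a₀ 0<a₁ zero          = 0<a₀
  all-positive 0<a₀ 0<a₁ (suc zero)    = 0<a₁
  all-positive 0<a₀ 0<a₁ (suc (suc n)) =
    subst (ℤ.0ℤ ℤ.<_) (sym (a-rec n))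
          (ℤP.+-mono-< (all-positive 0<a₀ 0<a₁ (suc n)) (all-positive 0<a₀ 0<a₁ n))

  χ-suc : ∀ m → χ (a (1 + m)) (a (2 + m)) ≡ ℤ.- χ (a m) (a (1 + m))
  χ-suc m = trans (cong (χ (a (1 + m))) (a-rec m)) (χ-step (a m) (a (1 + m)))

  χ-+2 : ∀ m → χ (a (2 + m)) (a (3 + m)) ≡ χ (a m) (a (1 + m))
  χ-+2 m = begin
    χ (a (2 + m)) (a (3 + m))      ≡⟨ χ-suc (1 + m) ⟩
    ℤ.- χ (a (1 + m)) (a (2 + m))  ≡⟨ cong ℤ.-_ (χ-suc m) ⟩
    ℤ.- ℤ.- χ (a m) (a (1 + m))    ≡⟨ ℤP.neg-involutive _ ⟩
    χ (a m) (a (1 + m)) ∎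

  χ-even : ∀ n → χ (a (2 * n)) (a (1 + 2 * n)) ≡ χ (a 0) (a 1)
  χ-even zero    = refl
  χ-even (suc n) = begin
    χ (a (2 * suc n)) (a (1 + 2 * suc n))  ≡⟨ cong (λ i → χ (a i) (a (1 + i))) (ℕP.*-suc 2 n) ⟩
    χ (a (2 + 2 * n)) (a (3 + 2 * n))      ≡⟨ χ-+2 (2 * n) ⟩
    χ (a (2 * n)) (a (1 + 2 * n))          ≡⟨ χ-even n ⟩
    χ (a 0) (a 1) ∎

  fib-shift : ∀ m k → a m ℤ.* ℤ.+ F k ℤ.+ a (suc m) ℤ.* ℤ.+ F (suc k) ≡ a (k + suc m)
  fib-shift m zero    =
    trans (cong₂ ℤ._+_ (ℤP.*-zeroʳ (a m)) (ℤP.*-identityʳ (a (suc m)))) (ℤP.+-identityˡ (a (suc m)))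
  fib-shift m (suc k) = begin
    a m ℤ.* ℤ.+ F (suc k) ℤ.+ a (suc m) ℤ.* ℤ.+ (F (suc k) + F k)
      ≡⟨ cong (λ t → a m ℤ.* ℤ.+ F (suc k) ℤ.+ a (suc m) ℤ.* t) (ℤP.pos-+ (F (suc k)) (F k)) ⟩
    a m ℤ.* ℤ.+ F (suc k) ℤ.+ a (suc m) ℤ.* (ℤ.+ F (suc k) ℤ.+ ℤ.+ F k)
      ≡⟨ regroup (a m) (a (suc m)) (ℤ.+ F k) (ℤ.+ F (suc k)) ⟩
    a (suc m) ℤ.* ℤ.+ F k ℤ.+ (a (suc m) ℤ.+ a m) ℤ.* ℤ.+ F (suc k)
      ≡⟨ cong (λ t → a (suc m) ℤ.* ℤ.+ F k ℤ.+ t ℤ.* ℤ.+ F (suc k)) (sym (a-rec m)) ⟩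
    a (suc m) ℤ.* ℤ.+ F k ℤ.+ a (suc (suc m)) ℤ.* ℤ.+ F (suc k)
      ≡⟨ fib-shift (suc m) k ⟩
    a (k + suc (suc m))
      ≡⟨ cong a (ℕP.+-suc k (suc m)) ⟩
    a (suc k + suc m) ∎
    where
    regroup : ∀ x y f f′ → x ℤ.* f′ ℤ.+ y ℤ.* (f′ ℤ.+ f) ≡ y ℤ.* f ℤ.+ (y ℤ.+ x) ℤ.* f′
    regroup = ℤSolver.solve-∀

  module Window (a-pos : ∀ n → ℤ.0ℤ ℤ.< a n) (N : ℕ) where

    x y z : ℤ
    x = a (N + 2)
    y = a (N + 3)
    z = a (N + 4)

    X Y Z : ℚ
    X = toℚ x
    Y = toℚ y
    Z = toℚ z

    y≡a[suc[N+2]] : y ≡ a (suc (N + 2))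
    y≡a[suc[N+2]] = cong a (ℕP.+-suc N 2)

    z≡y+x : z ≡ y ℤ.+ x
    z≡y+x = begin
      a (N + 4)                   ≡⟨ cong a (ℕP.+-suc N 3) ⟩
      a (suc (N + 3))             ≡⟨ cong (λ i → a (suc i)) (ℕP.+-suc N 2) ⟩
      a (2 + (N + 2))             ≡⟨ a-rec (N + 2) ⟩
      a (1 + (N + 2)) ℤ.+ x       ≡⟨ cong (ℤ._+ x) (sym y≡a[suc[N+2]]) ⟩
      y ℤ.+ x ∎

    window-fib-shift : ∀ k → x ℤ.* ℤ.+ F k ℤ.+ y ℤ.* ℤ.+ F (k + 1) ≡ a (N + 3 + k)
    window-fib-shift k = begin
      x ℤ.* ℤ.+ F k ℤ.+ y ℤ.* ℤ.+ F (k + 1)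
        ≡⟨ cong₂ (λ y′ j → x ℤ.* ℤ.+ F k ℤ.+ y′ ℤ.* ℤ.+ F j) y≡a[suc[N+2]] (ℕP.+-comm k 1) ⟩
      x ℤ.* ℤ.+ F k ℤ.+ a (suc (N + 2)) ℤ.* ℤ.+ F (suc k)
        ≡⟨ fib-shift (N + 2) k ⟩
      a (k + suc (N + 2))
        ≡⟨ cong a (index N k) ⟩
      a (N + 3 + k) ∎
      where
      index : ∀ N k → k + suc (N + 2) ≡ N + 3 + k
      index = ℕSolver.solve-∀

    toℚ[xyz]≡XYZ : toℚ (x ℤ.* y ℤ.* z) ≡ X ℚ.* Y ℚ.* Z
    toℚ[xyz]≡XYZ = trans (toℚ-* (x ℤ.* y) z) (cong (ℚ._* Z) (toℚ-* x y))

    toℚ[χ]≡XZ+XY-YZ : toℚ (χ x y) ≡ X ℚ.* Z ℚ.+ X ℚ.* Y ℚ.- Y ℚ.* Z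
    toℚ[χ]≡XZ+XY-YZ = begin
      toℚ (χ x y)                                   ≡⟨ cong toℚ (χ≡xz+xy-yz x y z z≡y+x) ⟩
      toℚ (x ℤ.* z ℤ.+ x ℤ.* y ℤ.- y ℤ.* z)         ≡⟨ toℚ-- (x ℤ.* z ℤ.+ x ℤ.* y) (y ℤ.* z) ⟩
      toℚ (x ℤ.* z ℤ.+ x ℤ.* y) ℚ.- toℚ (y ℤ.* z)
        ≡⟨ cong (ℚ._- toℚ (y ℤ.* z)) (toℚ-+ (x ℤ.* z) (x ℤ.* y)) ⟩
      toℚ (x ℤ.* z) ℚ.+ toℚ (x ℤ.* y) ℚ.- toℚ (y ℤ.* z)
        ≡⟨ cong₂ ℚ._-_ (cong₂ ℚ._+_ (toℚ-* x z) (toℚ-* x y)) (toℚ-* y z) ⟩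
      X ℚ.* Z ℚ.+ X ℚ.* Y ℚ.- Y ℚ.* Z ∎

    0<X : 0ℚ ℚ.< X
    0<X = toℚ-pos (a-pos (N + 2))
    0<Y : 0ℚ ℚ.< Y
    0<Y = toℚ-pos (a-pos (N + 3))
    0<Z : 0ℚ ℚ.< Z
    0<Z = toℚ-pos (a-pos (N + 4))

    fib-bound⇔inv-bound :
      ∀ {c} → ℤ.0ℤ ℤ.< c → ∀ k →
      (toℚ (x ℤ.* ℤ.+ F k ℤ.+ y ℤ.* ℤ.+ F (k + 1)) ℚ.≤ toℚ (x ℤ.* y ℤ.* z) ℚ.* inv (toℚ c))
      ⇔ (toℚ c ℚ.* inv (toℚ (x ℤ.* y ℤ.* z)) ℚ.≤ inv (toℚ (a (N + 3 + k))))
    fib-bound⇔inv-bound 0<c k rewrite window-fib-shift k =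
      ≤-*-inv⇔-*-inv-≤-inv (toℚ-pos (a-pos (N + 3 + k))) 0<xyz (toℚ-pos 0<c)
      where
      0<xyz : 0ℚ ℚ.< toℚ (x ℤ.* y ℤ.* z)
      0<xyz = subst (0ℚ ℚ.<_) (sym toℚ[xyz]≡XYZ) (*-pos (*-pos 0<X 0<Y) 0<Z)

    inv-bound⇒inv-sum-≤ :
      ∀ {c} → c ≡ χ x y → ∀ {b} → toℚ c ℚ.* inv (toℚ (x ℤ.* y ℤ.* z)) ℚ.≤ b →
      inv Y ℚ.+ inv Z ℚ.≤ inv X ℚ.+ b
    inv-bound⇒inv-sum-≤ refl {b} bound =
      subst (ℚ._≤ inv X ℚ.+ b) (sym inv-sum) (ℚP.+-monoʳ-≤ (inv X) bound)
      where
      inv-sum : inv Y ℚ.+ inv Z ≡ inv X ℚ.+ toℚ (χ x y) ℚ.* inv (toℚ (x ℤ.* y ℤ.* z))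
      inv-sum = begin
        inv Y ℚ.+ inv Z
          ≡⟨ inv+inv≡inv+[xz+xy-yz]*inv[xyz] (pos⇒≢0 0<X) (pos⇒≢0 0<Y) (pos⇒≢0 0<Z) ⟩
        inv X ℚ.+ (X ℚ.* Z ℚ.+ X ℚ.* Y ℚ.- Y ℚ.* Z) ℚ.* inv (X ℚ.* Y ℚ.* Z)
          ≡⟨ cong₂ (λ s t → inv X ℚ.+ s ℚ.* inv t) (sym toℚ[χ]≡XZ+XY-YZ) (sym toℚ[xyz]≡XYZ) ⟩
        inv X ℚ.+ toℚ (χ x y) ℚ.* inv (toℚ (x ℤ.* y ℤ.* z)) ∎

corollary2p3 : (a : ℕ → ℤ) →
    ℤ.0ℤ ℤ.< a 0 → ℤ.1ℤ ℤ.≤ a 1 → a 0 ℤ.≤ a 1 →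
    (∀ n → a (2 + n) ≡ a (1 + n) ℤ.+ a n) →
    ℤ.0ℤ ℤ.< a 0 ℤ.* a 0 ℤ.+ a 1 ℤ.* a 0 ℤ.- a 1 ℤ.* a 1 →
    (ξ : ℕ → ℕ) →
    (∀ n → IsGreatest
      (λ k → toℚ (a (2 * n + 2) ℤ.* ℤ.+ F k ℤ.+ a (2 * n + 3) ℤ.* ℤ.+ F (k + 1))
        ℚ.≤ toℚ (a (2 * n + 2) ℤ.* a (2 * n + 3) ℤ.* a (2 * n + 4))
            ℚ.* inv (toℚ (a 0 ℤ.* a 0 ℤ.+ a 1 ℤ.* a 0 ℤ.- a 1 ℤ.* a 1)))
      (ξ n)) →
    ∀ n →
      IsGreatest
        (λ k → toℚ (a 0 ℤ.* a 0 ℤ.+ a 1 ℤ.* a 0 ℤ.- a 1 ℤ.* a 1)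
                 ℚ.* inv (toℚ (a (2 * n + 2) ℤ.* a (2 * n + 3) ℤ.* a (2 * n + 4)))
               ℚ.≤ inv (toℚ (a (2 * n + 3 + k))))
        (ξ n)
      × (inv (toℚ (a (2 * n + 3))) ℚ.+ inv (toℚ (a (2 * n + 4)))
           ℚ.≤ inv (toℚ (a (2 * n + 2))) ℚ.+ inv (toℚ (a (2 * n + 3 + ξ n))))
corollary2p3 a 0<a₀ 1≤a₁ _ a-rec 0<χ ξ ξ-greatest n =
  < id , inv-bound⇒inv-sum-≤ χ₀≡χ[a₂ₙ₊₂,a₂ₙ₊₃] ∘ proj₁ >
    (IsGreatest-cong (fib-bound⇔inv-bound 0<χ) (ξ-greatest n))
  where
  open FibonacciLike a a-rec
  open Window (all-positive 0<a₀ (ℤP.suc[i]≤j⇒i<j 1≤a₁)) (2 * n)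
  χ₀≡χ[a₂ₙ₊₂,a₂ₙ₊₃] : χ (a 0) (a 1) ≡ χ (a (2 * n + 2)) (a (2 * n + 3))
  χ₀≡χ[a₂ₙ₊₂,a₂ₙ₊₃] = sym (begin
    χ (a (2 * n + 2)) (a (2 * n + 3))
      ≡⟨ cong₂ χ (cong a (ℕP.+-comm (2 * n) 2)) (cong a (ℕP.+-comm (2 * n) 3)) ⟩
    χ (a (2 + 2 * n)) (a (3 + 2 * n))
      ≡⟨ χ-+2 (2 * n) ⟩
    χ (a (2 * n)) (a (1 + 2 * n))
      ≡⟨ χ-even n ⟩
    χ (a 0) (a 1) ∎)
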